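{- $\omega\text{ - }{\sf SCAC}\equiv_W\mathsf{SCAC^{small}}\equiv_W\mathsf{SCAC^{large}}\equiv_W\mathsf{SCAC^{type}}$, i.e. these four problems are pairwise Weihrauch reducible to one another.
   Context: A poset $(P,\le_P)$ consists of $P\subseteq\omega$ and a reflexive, antisymmetric, transitive relation $\le_P$; chains (antichains) are sets of pairwise comparable (incomparable) elements; it is $\omega$-ordered if $x\le_P y$ implies $x\le y$. In an infinite poset, $x$ is small if $x\le_P y$ for all but finitely many $y\in P$, large if $y\le_P x$ for all but finitely many $y$, isolated if $x$ is incomparable with all but finitely many $y$. A poset is stable of the small type if every element is small or isolated, stable of the large type if every element is large or isolated, and stable if it is one of these. $\omega\text{ - }{\sf SCAC}$ is the problem whose instances are infinite $\omega$-ordered stable posets with $P\subseteq\omega$; $\mathsf{SCAC^{small}}$ (resp. $\mathsf{SCAC^{large}}$) has as instances infinite stable posets of the small (resp. large) type; $\mathsf{SCAC^{type}}$ has instances $(P,\le_P,T)$ with $(P,\le_P)$ an infinite stable poset, $T\in\{S,L\}$, and $T=S$ (resp. $L$) implying small (resp. large) type. In all cases solutions are infinite chains or infinite antichains of the poset. $\mathsf P\le_W\mathsf Q$ means there are fixed Turing functionals $\Phi,\Psi$ such that for every $\mathsf P$-instance $X$, $\Phi^X$ is a $\mathsf Q$-instance and for every solution $\hat Y$ of $\Phi^X$, $\Psi^{X\oplus\hat Y}$ is a solution of $X$. -}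

module Defs where

open import Data.Nat using (ℕ; zero; suc; _+_; _*_; _≤_; _<_)
open import Data.Nat.Properties using ()
open import Data.Fin using (Fin)
open import Data.Vec using (Vec; []; _∷_; lookup)
open import Data.Bool using (Bool; true; false; if_then_else_)
open import Data.Product using (Σ; _×_; _,_; ∃)
open import Data.Sum using (_⊎_)
open import Relation.Nullary using (¬_)
open import Relation.Binary.PropositionalEquality using (_≡_; _≢_)

-- Sets of naturals (oracles) are characteristic functions ℕ → Bool.

Real : Set
Real = ℕ → Bool

_∈ˢ_ : ℕ → Real → Set
n ∈ˢ X = X n ≡ true

double : ℕ → ℕ
double n = n + n

half : ℕ → ℕ
half zero = zero
half (suc zero) = zero
half (suc (suc n)) = suc (half n)

isEven : ℕ → Bool
isEven zero = true
isEven (suc zero) = false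
isEven (suc (suc n)) = isEven n

_⊕_ : Real → Real → Real
(X ⊕ Y) n = if isEven n then X (half n) else Y (half n)

tri : ℕ → ℕ
tri zero = zero
tri (suc n) = suc n + tri n

pair : ℕ → ℕ → ℕ
pair x y = tri (x + y) + y

data Code : ℕ → Set where
  cz   : ∀ {n} → Code n
  csuc : Code 1
  cprj : ∀ {n} → Fin n → Code n
  corc : Code 1
  ccmp : ∀ {m n} → Code m → Vec (Code n) m → Code n
  crec : ∀ {n} → Code n → Code (suc (suc n)) → Code (suc n)
  cmu  : ∀ {n} → Code (suc n) → Code n

bit : Bool → ℕ
bit true  = 1
bit false = 0

mutual
  data Eval (X : Real) : ∀ {n} → Code n → Vec ℕ n → ℕ → Set where
    ev-z   : ∀ {n} {xs : Vec ℕ n} → Eval X cz xs 0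
    ev-suc : ∀ {x} → Eval X csuc (x ∷ []) (suc x)
    ev-prj : ∀ {n} {i : Fin n} {xs} → Eval X (cprj i) xs (lookup xs i)
    ev-orc : ∀ {x} → Eval X corc (x ∷ []) (bit (X x))
    ev-cmp : ∀ {m n} {f : Code m} {gs : Vec (Code n) m} {xs ys y} →
             EvalAll X gs xs ys → Eval X f ys y → Eval X (ccmp f gs) xs y
    ev-rec0 : ∀ {n} {g : Code n} {h} {xs y} →
             Eval X g xs y → Eval X (crec g h) (0 ∷ xs) y
    ev-recS : ∀ {n} {g : Code n} {h} {k xs r y} →
             Eval X (crec g h) (k ∷ xs) r → Eval X h (k ∷ r ∷ xs) y →
             Eval X (crec g h) (suc k ∷ xs) y
    ev-mu  : ∀ {n} {f : Code (suc n)} {xs y} →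
             Eval X f (y ∷ xs) 0 →
             (∀ i → i < y → Σ ℕ (λ k → Eval X f (i ∷ xs) (suc k))) →
             Eval X (cmu f) xs y

  data EvalAll (X : Real) {n : ℕ} : ∀ {m} → Vec (Code n) m → Vec ℕ n → Vec ℕ m → Set where
    ea-[] : ∀ {xs} → EvalAll X [] xs []
    ea-∷  : ∀ {m} {g : Code n} {gs : Vec (Code n) m} {xs y ys} →
            Eval X g xs y → EvalAll X gs xs ys → EvalAll X (g ∷ gs) xs (y ∷ ys)

TuringFunctional : Set
TuringFunctional = Code 1

_^_≣_ : TuringFunctional → Real → Real → Set
Φ ^ X ≣ Y = ∀ n → Eval X Φ (n ∷ []) (bit (Y n))

record Problem : Set₁ where
  field
    Inst : Real → Set
    Sol  : Real → Real → Set
open Problem public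

_≤W_ : Problem → Problem → Set
P ≤W Q = Σ TuringFunctional λ Φ → Σ TuringFunctional λ Ψ →
  ∀ X → Inst P X →
    Σ Real λ Z → (Φ ^ X ≣ Z) × Inst Q Z ×
      (∀ Ŷ → Sol Q Z Ŷ → Σ Real λ Y → (Ψ ^ (X ⊕ Ŷ) ≣ Y) × Sol P X Y)

_≡W_ : Problem → Problem → Set
P ≡W Q = (P ≤W Q) × (Q ≤W P)

-- Posets coded by a single set X:
--   P   = {x | 2x ∈ X},
--   x ≤_P y  iff  x ∈ P, y ∈ P and 2⟨x,y⟩+1 ∈ X.

record CPoset : Set where
  constructor poset
  field code : Real

  Dom : ℕ → Set
  Dom x = x ∈ˢ (λ n → code (double n))

  _≤P_ : ℕ → ℕ → Set
  x ≤P y = Dom x × Dom y × (suc (double (pair x y)) ∈ˢ code)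

  Comparable : ℕ → ℕ → Set
  Comparable x y = (x ≤P y) ⊎ (y ≤P x)

  IsPoset : Set
  IsPoset = (∀ x → Dom x → x ≤P x)
          × (∀ x y → x ≤P y → y ≤P x → x ≡ y)
          × (∀ x y z → x ≤P y → y ≤P z → x ≤P z)

  Infinite : Set
  Infinite = ∀ n → Σ ℕ λ m → n ≤ m × Dom m

  ωOrdered : Set
  ωOrdered = ∀ x y → x ≤P y → x ≤ y

  Small : ℕ → Set
  Small x = Σ ℕ λ b → ∀ y → Dom y → b ≤ y → x ≤P y

  Large : ℕ → Set
  Large x = Σ ℕ λ b → ∀ y → Dom y → b ≤ y → y ≤P x

  Isolated : ℕ → Set
  Isolated x = Σ ℕ λ b → ∀ y → Dom y → b ≤ y → ¬ Comparable x y

  StableSmall : Set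
  StableSmall = ∀ x → Dom x → Small x ⊎ Isolated x

  StableLarge : Set
  StableLarge = ∀ x → Dom x → Large x ⊎ Isolated x

  Stable : Set
  Stable = StableSmall ⊎ StableLarge

  InfiniteSubset : Real → Set
  InfiniteSubset Y = (∀ y → y ∈ˢ Y → Dom y) × (∀ n → Σ ℕ λ m → n ≤ m × m ∈ˢ Y)

  Chain : Real → Set
  Chain Y = ∀ x y → x ∈ˢ Y → y ∈ˢ Y → Comparable x y

  Antichain : Real → Set
  Antichain Y = ∀ x y → x ∈ˢ Y → y ∈ˢ Y → x ≢ y → ¬ Comparable x y

  ChainOrAntichain : Real → Set
  ChainOrAntichain Y = InfiniteSubset Y × (Chain Y ⊎ Antichain Y)

open CPoset public

ω-SCAC : Problem
ω-SCAC = record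
  { Inst = λ X → IsPoset (poset X) × Infinite (poset X) × ωOrdered (poset X) × Stable (poset X)
  ; Sol  = λ X Y → ChainOrAntichain (poset X) Y }

SCAC-small : Problem
SCAC-small = record
  { Inst = λ X → IsPoset (poset X) × Infinite (poset X) × StableSmall (poset X)
  ; Sol  = λ X Y → ChainOrAntichain (poset X) Y }

SCAC-large : Problem
SCAC-large = record
  { Inst = λ X → IsPoset (poset X) × Infinite (poset X) × StableLarge (poset X)
  ; Sol  = λ X Y → ChainOrAntichain (poset X) Y }

-- SCAC^type instance (P, ≤_P, T) coded by X: T = S iff X 0 = true (T = L iff X 0 = false),
-- and the poset is coded by n ↦ X (n+1).
typeBit : Real → Bool
typeBit X = X 0

typePoset : Real → CPoset
typePoset X = poset (λ n → X (suc n))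

SCAC-type : Problem
SCAC-type = record
  { Inst = λ X → IsPoset (typePoset X) × Infinite (typePoset X) × Stable (typePoset X)
               × (typeBit X ≡ true → StableSmall (typePoset X))
               × (typeBit X ≡ false → StableLarge (typePoset X))
  ; Sol  = λ X Y → ChainOrAntichain (typePoset X) Y }

-- Five of the six reductions leave solutions unchanged: an infinite ω-ordered poset has no
-- large elements, so if it is stable it is of the small type; passing to the opposite order
-- exchanges small and large elements; and a type bit can be prepended, or read to decide
-- whether to pass to the opposite order.
-- For SCAC^small ≤ ω-SCAC, intersect ≤_P with the order of ω. This gives an ω-ordered stable
-- poset of the small type whose chains are chains of P. An antichain Y of it may still contain
-- m < n with n <_P m, so keep only the elements of Y lying below no earlier element of Y.
-- They form an antichain of P, and an infinite one because the elements of Y are isolated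
-- in P (a small one would lie below later elements of Y).

module Submission where

open import Defs
open import Data.Bool using (Bool; true; false; if_then_else_; _∧_; not)
open import Data.Bool.Properties using (if-float; not-involutive)
open import Data.Fin using (Fin; #_)
open import Data.Nat using (ℕ; zero; suc; pred; _+_; _∸_; _≤_; _<_; _⊔_; _≤?_; _<?_; s≤s)
open import Data.Nat.Properties
open import Data.Nat.Induction using (<-rec)
open import Data.Empty using (⊥; ⊥-elim)
open import Data.Product using (Σ; _×_; _,_; proj₁; proj₂)
open import Data.Sum using (_⊎_; inj₁; inj₂; swap)
open import Data.Vec using (Vec; []; _∷_; lookup)
open import Function using (mk⇔)
open import Relation.Nullary using (¬_; Dec; does; yes; no)
open import Relation.Nullary.Decidable using (does-⇔; dec-true; dec-false; _×-dec_)
open import Relation.Binary.Definitions using (tri<; tri≈; tri>)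
open import Relation.Binary.PropositionalEquality hiding (poset)

-- Computability relative to an oracle

OracleFn : ℕ → Set
OracleFn n = Real → Vec ℕ n → ℕ

record Computable {n : ℕ} (f : OracleFn n) : Set where
  constructor computable
  field
    program  : Code n
    computes : ∀ X xs → Eval X program xs (f X xs)
open Computable

Computableᵇ : ∀ {n} → (Real → Vec ℕ n → Bool) → Set
Computableᵇ b = Computable (λ X xs → bit (b X xs))

computable-≗ : ∀ {n} {f g : OracleFn n} → Computable f → (∀ X xs → f X xs ≡ g X xs) → Computable g
computable-≗ (computable c ev) f≗g = computable c (λ X xs → subst (Eval X c xs) (f≗g X xs) (ev X xs))

compose₁ : ∀ {n} {f : OracleFn 1} {g : OracleFn n} →
           Computable f → Computable g → Computable (λ X xs → f X (g X xs ∷ []))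
compose₁ (computable cf evf) (computable cg evg) =
  computable (ccmp cf (cg ∷ [])) (λ X xs → ev-cmp (ea-∷ (evg X xs) ea-[]) (evf X _))

compose₂ : ∀ {n} {f : OracleFn 2} {g h : OracleFn n} →
           Computable f → Computable g → Computable h →
           Computable (λ X xs → f X (g X xs ∷ h X xs ∷ []))
compose₂ (computable cf evf) (computable cg evg) (computable ch evh) =
  computable (ccmp cf (cg ∷ ch ∷ []))
             (λ X xs → ev-cmp (ea-∷ (evg X xs) (ea-∷ (evh X xs) ea-[])) (evf X _))

compose₃ : ∀ {n} {f : OracleFn 3} {g h k : OracleFn n} →
           Computable f → Computable g → Computable h → Computable k →
           Computable (λ X xs → f X (g X xs ∷ h X xs ∷ k X xs ∷ []))
compose₃ (computable cf evf) (computable cg evg) (computable ch evh) (computable ck evk) =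
  computable (ccmp cf (cg ∷ ch ∷ ck ∷ []))
             (λ X xs → ev-cmp (ea-∷ (evg X xs) (ea-∷ (evh X xs) (ea-∷ (evk X xs) ea-[]))) (evf X _))

primRec : ∀ {n} {g : OracleFn n} {h : OracleFn (suc (suc n))} →
          Computable g → Computable h → (R : OracleFn (suc n)) →
          (∀ X xs → R X (0 ∷ xs) ≡ g X xs) →
          (∀ X k xs → R X (suc k ∷ xs) ≡ h X (k ∷ R X (k ∷ xs) ∷ xs)) →
          Computable R
primRec (computable cg evg) (computable ch evh) R R-zero R-suc = computable (crec cg ch) evR
  where
  evR : ∀ X xs → Eval X (crec cg ch) xs (R X xs)
  evR X (zero ∷ xs)  = subst (Eval X (crec cg ch) _) (sym (R-zero X xs)) (ev-rec0 (evg X xs))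
  evR X (suc k ∷ xs) = subst (Eval X (crec cg ch) _) (sym (R-suc X k xs))
                             (ev-recS (evR X (k ∷ xs)) (evh X _))

computable-zero : ∀ {n} → Computable {n} (λ _ _ → 0)
computable-zero = computable cz (λ _ _ → ev-z)

computable-var : ∀ {n} (i : Fin n) → Computable (λ _ xs → lookup xs i)
computable-var i = computable (cprj i) (λ _ _ → ev-prj)

var₀ : ∀ {n} → Computable {suc n} (λ _ xs → lookup xs (# 0))
var₀ = computable-var (# 0)

var₁ : ∀ {n} → Computable {suc (suc n)} (λ _ xs → lookup xs (# 1))
var₁ = computable-var (# 1)

computable-suc : ∀ {n} {f : OracleFn n} → Computable f → Computable (λ X xs → suc (f X xs))
computable-suc = compose₁ {f = λ _ xs → suc (lookup xs (# 0))} (computable csuc (λ { _ (_ ∷ []) → ev-suc }))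

computable-query : ∀ {n} {f : OracleFn n} → Computable f → Computableᵇ (λ X xs → X (f X xs))
computable-query = compose₁ {f = λ X xs → bit (X (lookup xs (# 0)))} (computable corc (λ { _ (_ ∷ []) → ev-orc }))

computable-true : ∀ {n} → Computableᵇ {n} (λ _ _ → true)
computable-true = computable-suc computable-zero

computable-false : ∀ {n} → Computableᵇ {n} (λ _ _ → false)
computable-false = computable-zero

computable-if : ∀ {n} {c : Real → Vec ℕ n → Bool} {f g : OracleFn n} →
                Computableᵇ c → Computable f → Computable g →
                Computable (λ X xs → if c X xs then f X xs else g X xs)
computable-if {c = c} {f} {g} cc cf cg = computable-≗ (compose₃ computable-choose cc cf cg) choose-bit
  where
  choose : OracleFn 3
  choose _ (zero  ∷ a ∷ b ∷ []) = b
  choose _ (suc _ ∷ a ∷ b ∷ []) = a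
  computable-choose : Computable choose
  computable-choose = primRec var₁ (computable-var (# 2)) choose
                              (λ { _ (a ∷ b ∷ []) → refl }) (λ { _ _ (a ∷ b ∷ []) → refl })
  choose-bit : ∀ X xs → choose X (bit (c X xs) ∷ f X xs ∷ g X xs ∷ []) ≡ (if c X xs then f X xs else g X xs)
  choose-bit X xs with c X xs
  ... | true  = refl
  ... | false = refl

computable-∧ : ∀ {n} {a b : Real → Vec ℕ n → Bool} →
               Computableᵇ a → Computableᵇ b → Computableᵇ (λ X xs → a X xs ∧ b X xs)
computable-∧ {a = a} {b} ca cb = computable-≗ (computable-if ca cb computable-false) if≡∧
  where
  if≡∧ : ∀ X xs → (if a X xs then bit (b X xs) else 0) ≡ bit (a X xs ∧ b X xs)
  if≡∧ X xs with a X xs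
  ... | true  = refl
  ... | false = refl

computable-pred : ∀ {n} {f : OracleFn n} → Computable f → Computable (λ X xs → pred (f X xs))
computable-pred = compose₁ (primRec computable-zero var₀
                                    (λ _ xs → pred (lookup xs (# 0)))
                                    (λ { _ [] → refl }) (λ { _ _ [] → refl }))

computable-+ : ∀ {n} {f g : OracleFn n} → Computable f → Computable g →
               Computable (λ X xs → f X xs + g X xs)
computable-+ = compose₂ (primRec var₀ (computable-suc var₁)
                                 (λ _ xs → lookup xs (# 0) + lookup xs (# 1))
                                 (λ { _ (_ ∷ []) → refl }) (λ { _ _ (_ ∷ []) → refl }))

computable-∸ : ∀ {n} {f g : OracleFn n} → Computable f → Computable g →
               Computable (λ X xs → f X xs ∸ g X xs)
computable-∸ cf cg = compose₂ monus cg cf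
  where
  monus : Computable (λ _ xs → lookup xs (# 1) ∸ lookup xs (# 0))
  monus = primRec var₀ (computable-pred var₁) _
                  (λ { _ (_ ∷ []) → refl })
                  (λ { _ k (a ∷ []) → sym (pred[m∸n]≡m∸[1+n] a k) })

computable-≟0 : ∀ {n} {f : OracleFn n} → Computable f → Computableᵇ (λ X xs → does (f X xs ≟ 0))
computable-≟0 = compose₁ (primRec computable-true computable-false
                                  (λ _ xs → bit (does (lookup xs (# 0) ≟ 0)))
                                  (λ { _ [] → refl }) (λ { _ _ [] → refl }))

does-bit≟0 : ∀ b → does (bit b ≟ 0) ≡ not b
does-bit≟0 true  = refl
does-bit≟0 false = refl

computable-not : ∀ {n} {a : Real → Vec ℕ n → Bool} → Computableᵇ a → Computableᵇ (λ X xs → not (a X xs))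
computable-not {a = a} ca = computable-≗ (computable-≟0 ca) (λ X xs → cong bit (does-bit≟0 (a X xs)))

computable-≤? : ∀ {n} {f g : OracleFn n} → Computable f → Computable g →
                Computableᵇ (λ X xs → does (f X xs ≤? g X xs))
computable-≤? {f = f} {g} cf cg = computable-≗ (computable-≟0 (computable-∸ cf cg)) ∸≟0≡≤?
  where
  ∸≟0≡≤? : ∀ X xs → bit (does (f X xs ∸ g X xs ≟ 0)) ≡ bit (does (f X xs ≤? g X xs))
  ∸≟0≡≤? X xs = cong bit (does-⇔ (mk⇔ m∸n≡0⇒m≤n m≤n⇒m∸n≡0) (f X xs ∸ g X xs ≟ 0) (f X xs ≤? g X xs))

computable-≟ : ∀ {n} {f g : OracleFn n} → Computable f → Computable g →
               Computableᵇ (λ X xs → does (f X xs ≟ g X xs))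
computable-≟ {f = f} {g} cf cg =
  computable-≗ (computable-∧ (computable-≤? cf cg) (computable-≤? cg cf)) ≤?∧≥?≡≟
  where
  ≤?∧≥?≡≟ : ∀ X xs → bit (does (f X xs ≤? g X xs) ∧ does (g X xs ≤? f X xs)) ≡
                      bit (does (f X xs ≟ g X xs))
  ≤?∧≥?≡≟ X xs =
    cong bit (does-⇔ (mk⇔ (λ (p , q) → ≤-antisym p q) (λ eq → ≤-reflexive eq , ≤-reflexive (sym eq)))
                     (f X xs ≤? g X xs ×-dec g X xs ≤? f X xs) (f X xs ≟ g X xs))

isEven-suc : ∀ k → isEven (suc k) ≡ not (isEven k)
isEven-suc zero          = refl
isEven-suc (suc zero)    = refl
isEven-suc (suc (suc k)) = isEven-suc k

half-suc : ∀ k → half (suc k) ≡ half k + bit (not (isEven k))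
half-suc zero          = refl
half-suc (suc zero)    = refl
half-suc (suc (suc k)) = cong suc (half-suc k)

double-suc : ∀ m → double (suc m) ≡ suc (suc (double m))
double-suc m = cong suc (+-suc m m)

isEven-double : ∀ m → isEven (double m) ≡ true
isEven-double zero    = refl
isEven-double (suc m) = trans (cong isEven (double-suc m)) (isEven-double m)

isEven-suc-double : ∀ m → isEven (suc (double m)) ≡ false
isEven-suc-double m = trans (isEven-suc (double m)) (cong not (isEven-double m))

half-double : ∀ m → half (double m) ≡ m
half-double zero    = refl
half-double (suc m) = trans (cong half (double-suc m)) (cong suc (half-double m))

half-suc-double : ∀ m → half (suc (double m)) ≡ m
half-suc-double m = trans (half-suc (double m)) (begin
  half (double m) + bit (not (isEven (double m))) ≡⟨ cong₂ (λ h e → h + bit (not e)) (half-double m) (isEven-double m) ⟩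
  m + 0                                           ≡⟨ +-identityʳ m ⟩
  m                                               ∎)
  where open ≡-Reasoning

⊕-double : ∀ X Y m → (X ⊕ Y) (double m) ≡ X m
⊕-double X Y m rewrite isEven-double m | half-double m = refl

⊕-suc-double : ∀ X Y m → (X ⊕ Y) (suc (double m)) ≡ Y m
⊕-suc-double X Y m rewrite isEven-suc-double m | half-suc-double m = refl

tri-suc : ∀ t → tri (suc t) ≡ suc (tri t + t)
tri-suc t = cong suc (+-comm t (tri t))

-- diagonal p is the d with tri d ≤ p < tri (suc d); it steps up exactly at triangular numbers.
diagonal : ℕ → ℕ
diagonal zero    = zero
diagonal (suc p) = diagonal p + bit (does (suc p ≟ tri (suc (diagonal p))))

unpair₂ : ℕ → ℕ
unpair₂ p = p ∸ tri (diagonal p)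

unpair₁ : ℕ → ℕ
unpair₁ p = diagonal p ∸ unpair₂ p

diagonal-suc : ∀ {p t} → diagonal p ≡ t → diagonal (suc p) ≡ t + bit (does (suc p ≟ tri (suc t)))
diagonal-suc refl = refl

diagonal-tri+ : ∀ t y → y ≤ t → diagonal (tri t + y) ≡ t
diagonal-tri+ zero    zero    _ = refl
diagonal-tri+ (suc t) zero    _ = begin
  diagonal (tri (suc t) + 0)                      ≡⟨ cong diagonal (trans (+-identityʳ _) (tri-suc t)) ⟩
  diagonal (suc (tri t + t))                      ≡⟨ diagonal-suc {tri t + t} (diagonal-tri+ t t ≤-refl) ⟩
  t + bit (does (suc (tri t + t) ≟ tri (suc t))) ≡⟨ cong (λ b → t + bit b) (dec-true (_ ≟ _) (sym (tri-suc t))) ⟩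
  t + 1                                           ≡⟨ +-comm t 1 ⟩
  suc t                                           ∎
  where open ≡-Reasoning
diagonal-tri+ t (suc y) y<t = begin
  diagonal (tri t + suc y)                        ≡⟨ cong diagonal (+-suc (tri t) y) ⟩
  diagonal (suc (tri t + y))                      ≡⟨ diagonal-suc {tri t + y} (diagonal-tri+ t y (<⇒≤ y<t)) ⟩
  t + bit (does (suc (tri t + y) ≟ tri (suc t))) ≡⟨ cong (λ b → t + bit b) (dec-false (_ ≟ _) (<⇒≢ below-next)) ⟩
  t + 0                                           ≡⟨ +-identityʳ t ⟩
  t                                               ∎
  where
  open ≡-Reasoning
  below-next : suc (tri t + y) < tri (suc t)
  below-next = s≤s (subst (tri t + y <_) (+-comm (tri t) t) (+-monoʳ-< (tri t) y<t))

diagonal-pair : ∀ x y → diagonal (pair x y) ≡ x + y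
diagonal-pair x y = diagonal-tri+ (x + y) y (m≤n+m y x)

unpair₂-pair : ∀ x y → unpair₂ (pair x y) ≡ y
unpair₂-pair x y = trans (cong (λ d → pair x y ∸ tri d) (diagonal-pair x y)) (m+n∸m≡n (tri (x + y)) y)

unpair₁-pair : ∀ x y → unpair₁ (pair x y) ≡ x
unpair₁-pair x y = trans (cong₂ _∸_ (diagonal-pair x y) (unpair₂-pair x y)) (m+n∸n≡m x y)

computable-isEven : ∀ {n} {f : OracleFn n} → Computable f → Computableᵇ (λ X xs → isEven (f X xs))
computable-isEven = compose₁ (primRec computable-true (computable-≟0 var₁)
  (λ _ xs → bit (isEven (lookup xs (# 0))))
  (λ { _ [] → refl })
  (λ { _ k [] → cong bit (trans (isEven-suc k) (sym (does-bit≟0 (isEven k)))) }))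

computable-half : ∀ {n} {f : OracleFn n} → Computable f → Computable (λ X xs → half (f X xs))
computable-half = compose₁ (primRec computable-zero
  (computable-+ var₁ (computable-not (computable-isEven var₀)))
  (λ _ xs → half (lookup xs (# 0)))
  (λ { _ [] → refl })
  (λ { _ k [] → half-suc k }))

computable-double : ∀ {n} {f : OracleFn n} → Computable f → Computable (λ X xs → double (f X xs))
computable-double cf = computable-+ cf cf

computable-tri : ∀ {n} {f : OracleFn n} → Computable f → Computable (λ X xs → tri (f X xs))
computable-tri = compose₁ (primRec computable-zero
  (computable-+ (computable-suc var₀) var₁)
  (λ _ xs → tri (lookup xs (# 0)))
  (λ { _ [] → refl })
  (λ { _ _ [] → refl }))

computable-pair : ∀ {n} {f g : OracleFn n} → Computable f → Computable g →
                  Computable (λ X xs → pair (f X xs) (g X xs))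
computable-pair cf cg = computable-+ (computable-tri (computable-+ cf cg)) cg

computable-diagonal : ∀ {n} {f : OracleFn n} → Computable f → Computable (λ X xs → diagonal (f X xs))
computable-diagonal = compose₁ (primRec computable-zero
  (computable-+ var₁
                (computable-≟ (computable-suc var₀)
                              (computable-tri (computable-suc var₁))))
  (λ _ xs → diagonal (lookup xs (# 0)))
  (λ { _ [] → refl })
  (λ { _ _ [] → refl }))

computable-unpair₂ : ∀ {n} {f : OracleFn n} → Computable f → Computable (λ X xs → unpair₂ (f X xs))
computable-unpair₂ cf = computable-∸ cf (computable-tri (computable-diagonal cf))

computable-unpair₁ : ∀ {n} {f : OracleFn n} → Computable f → Computable (λ X xs → unpair₁ (f X xs))
computable-unpair₁ cf = computable-∸ (computable-diagonal cf) (computable-unpair₂ cf)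

record TuringComputable (F : Real → Real) : Set where
  constructor turingComputable
  field pointwise : Computableᵇ {1} (λ X xs → F X (lookup xs (# 0)))
open TuringComputable

functional : ∀ {F} → TuringComputable F → TuringFunctional
functional cF = program (pointwise cF)

functional-≣ : ∀ {F} (cF : TuringComputable F) X → functional cF ^ X ≣ F X
functional-≣ cF X n = computes (pointwise cF) X (n ∷ [])

≣-cong : ∀ {Φ X Y Z} → Φ ^ X ≣ Y → (∀ n → Y n ≡ Z n) → Φ ^ X ≣ Z
≣-cong {Φ} {X} Φ≣Y Y≗Z n = subst (λ b → Eval X Φ (n ∷ []) (bit b)) (Y≗Z n) (Φ≣Y n)

query-through : ∀ {F n} {f : OracleFn n} → TuringComputable F → Computable f →
                Computableᵇ (λ X xs → F X (f X xs))
query-through cF = compose₁ (pointwise cF)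

≤W-intro : ∀ {P Q : Problem} (F : Real → Real) (G : Real → Real → Real) (Ψ : TuringFunctional) →
           TuringComputable F → (∀ X Ŷ → Ψ ^ (X ⊕ Ŷ) ≣ G X Ŷ) →
           (∀ X → Inst P X → Inst Q (F X)) →
           (∀ X Ŷ → Inst P X → Sol Q (F X) Ŷ → Sol P X (G X Ŷ)) → P ≤W Q
≤W-intro F G Ψ cF ΨG inst sol =
  functional cF , Ψ , λ X i → F X , functional-≣ cF X , inst X i , λ Ŷ s → G X Ŷ , ΨG X Ŷ , sol X Ŷ i s

computable-rightHalf : TuringComputable (λ W n → W (suc (double n)))
computable-rightHalf = turingComputable (computable-query (computable-suc (computable-double var₀)))

rightHalf-⊕ : ∀ X Ŷ → functional computable-rightHalf ^ (X ⊕ Ŷ) ≣ Ŷ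
rightHalf-⊕ X Ŷ = ≣-cong (functional-≣ computable-rightHalf (X ⊕ Ŷ)) (⊕-suc-double X Ŷ)

≤W-byInstances : ∀ {P Q : Problem} (F : Real → Real) → TuringComputable F →
                 (∀ X → Inst P X → Inst Q (F X)) →
                 (∀ X Ŷ → Inst P X → Sol Q (F X) Ŷ → Sol P X Ŷ) → P ≤W Q
≤W-byInstances F cF = ≤W-intro F (λ _ Ŷ → Ŷ) (functional computable-rightHalf) cF rightHalf-⊕

computable-id : TuringComputable (λ X → X)
computable-id = turingComputable (computable-query var₀)

ωOrdered⇒¬large : ∀ (P : CPoset) → Infinite P → ωOrdered P → ∀ x → ¬ Large P x
ωOrdered⇒¬large P inf ω x (b , large) =
  let (m , b⊔1+x≤m , dm) = inf (b ⊔ suc x)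
  in <⇒≱ (≤-trans (m≤n⊔m b (suc x)) b⊔1+x≤m)
         (ω m x (large m dm (≤-trans (m≤m⊔n b (suc x)) b⊔1+x≤m)))

ωOrdered-stable⇒stableSmall : ∀ (P : CPoset) → Infinite P → ωOrdered P → Stable P → StableSmall P
ωOrdered-stable⇒stableSmall P inf ω (inj₁ stable) = stable
ωOrdered-stable⇒stableSmall P inf ω (inj₂ stable) x dx with stable x dx
... | inj₁ large = ⊥-elim (ωOrdered⇒¬large P inf ω x large)
... | inj₂ isol  = inj₂ isol

ω-SCAC≤SCAC-small : ω-SCAC ≤W SCAC-small
ω-SCAC≤SCAC-small = ≤W-byInstances (λ X → X) computable-id
  (λ X (isP , inf , ω , stable) → isP , inf , ωOrdered-stable⇒stableSmall (poset X) inf ω stable)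
  (λ _ _ _ sol → sol)

-- Opposite posets

opposite : Real → Real
opposite X n = if isEven n then X n else X (suc (double (pair (unpair₂ (half n)) (unpair₁ (half n)))))

opposite-double : ∀ X x → opposite X (double x) ≡ X (double x)
opposite-double X x rewrite isEven-double x = refl

opposite-order : ∀ X x y → opposite X (suc (double (pair x y))) ≡ X (suc (double (pair y x)))
opposite-order X x y rewrite isEven-suc-double (pair x y) | half-suc-double (pair x y)
                          | unpair₁-pair x y | unpair₂-pair x y = refl

computable-opposite : ∀ {F} → TuringComputable F → TuringComputable (λ X → opposite (F X))
computable-opposite cF = turingComputable (computable-≗ (computable-if (computable-isEven var₀) (query-through cF var₀)
  (query-through cF (computable-suc (computable-double
    (computable-pair (computable-unpair₂ (computable-half var₀)) (computable-unpair₁ (computable-half var₀)))))))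
  (λ X xs → sym (if-float bit (isEven (lookup xs (# 0))))))

module Opposite (X : Real) where
  private
    P   = poset X
    Pᵒᵖ = poset (opposite X)

  dom-op : ∀ x → Dom P x → Dom Pᵒᵖ x
  dom-op x = trans (opposite-double X x)

  dom-unop : ∀ x → Dom Pᵒᵖ x → Dom P x
  dom-unop x = trans (sym (opposite-double X x))

  ≤-op : ∀ x y → _≤P_ P y x → _≤P_ Pᵒᵖ x y
  ≤-op x y (dy , dx , y≤x) = dom-op x dx , dom-op y dy , trans (opposite-order X x y) y≤x

  ≤-unop : ∀ x y → _≤P_ Pᵒᵖ x y → _≤P_ P y x
  ≤-unop x y (dx , dy , x≤y) = dom-unop y dy , dom-unop x dx , trans (sym (opposite-order X x y)) x≤y

  comparable-op : ∀ x y → Comparable P x y → Comparable Pᵒᵖ x y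
  comparable-op x y (inj₁ x≤y) = inj₂ (≤-op y x x≤y)
  comparable-op x y (inj₂ y≤x) = inj₁ (≤-op x y y≤x)

  comparable-unop : ∀ x y → Comparable Pᵒᵖ x y → Comparable P x y
  comparable-unop x y (inj₁ x≤y) = inj₂ (≤-unop x y x≤y)
  comparable-unop x y (inj₂ y≤x) = inj₁ (≤-unop y x y≤x)

  isPoset-op : IsPoset P → IsPoset Pᵒᵖ
  isPoset-op (refl′ , antisym , trans′) =
    (λ x dx → ≤-op x x (refl′ x (dom-unop x dx))) ,
    (λ x y x≤y y≤x → antisym x y (≤-unop y x y≤x) (≤-unop x y x≤y)) ,
    (λ x y z x≤y y≤z → ≤-op x z (trans′ z y x (≤-unop y z y≤z) (≤-unop x y x≤y)))

  infinite-op : Infinite P → Infinite Pᵒᵖ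
  infinite-op inf n = let (m , n≤m , dm) = inf n in m , n≤m , dom-op m dm

  isolated-op : ∀ x → Isolated P x → Isolated Pᵒᵖ x
  isolated-op x (b , isol) = b , λ y dy b≤y c → isol y (dom-unop y dy) b≤y (comparable-unop x y c)

  stableSmall-op : StableSmall P → StableLarge Pᵒᵖ
  stableSmall-op stable x dx with stable x (dom-unop x dx)
  ... | inj₁ (b , small) = inj₁ (b , λ y dy b≤y → ≤-op y x (small y (dom-unop y dy) b≤y))
  ... | inj₂ isol        = inj₂ (isolated-op x isol)

  stableLarge-op : StableLarge P → StableSmall Pᵒᵖ
  stableLarge-op stable x dx with stable x (dom-unop x dx)
  ... | inj₁ (b , large) = inj₁ (b , λ y dy b≤y → ≤-op x y (large y (dom-unop y dy) b≤y))
  ... | inj₂ isol        = inj₂ (isolated-op x isol)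

  solution-unop : ∀ Y → ChainOrAntichain Pᵒᵖ Y → ChainOrAntichain P Y
  solution-unop Y ((sub , inf) , inj₁ chain) =
    ((λ y y∈Y → dom-unop y (sub y y∈Y)) , inf) ,
    inj₁ (λ x y x∈Y y∈Y → comparable-unop x y (chain x y x∈Y y∈Y))
  solution-unop Y ((sub , inf) , inj₂ antichain) =
    ((λ y y∈Y → dom-unop y (sub y y∈Y)) , inf) ,
    inj₂ (λ x y x∈Y y∈Y x≢y c → antichain x y x∈Y y∈Y x≢y (comparable-op x y c))

SCAC-small≤SCAC-large : SCAC-small ≤W SCAC-large
SCAC-small≤SCAC-large = ≤W-byInstances opposite (computable-opposite computable-id)
  (λ X (isP , inf , stable) → let open Opposite X in isPoset-op isP , infinite-op inf , stableSmall-op stable)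
  (λ X Ŷ _ → Opposite.solution-unop X Ŷ)

SCAC-large≤SCAC-small : SCAC-large ≤W SCAC-small
SCAC-large≤SCAC-small = ≤W-byInstances opposite (computable-opposite computable-id)
  (λ X (isP , inf , stable) → let open Opposite X in isPoset-op isP , infinite-op inf , stableLarge-op stable)
  (λ X Ŷ _ → Opposite.solution-unop X Ŷ)

typedLarge : Real → Real
typedLarge X zero    = false
typedLarge X (suc n) = X n

computable-typedLarge : TuringComputable typedLarge
computable-typedLarge = turingComputable (computable-≗
  (computable-if (computable-≟0 var₀) computable-false (computable-query (computable-pred var₀)))
  (λ { X (zero ∷ []) → refl ; X (suc _ ∷ []) → refl }))

SCAC-large≤SCAC-type : SCAC-large ≤W SCAC-type
SCAC-large≤SCAC-type = ≤W-byInstances typedLarge computable-typedLarge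
  (λ X (isP , inf , stable) → isP , inf , inj₂ stable , (λ ()) , (λ _ → stable))
  (λ _ _ _ sol → sol)

dropType : Real → Real
dropType X n = X (suc n)

largeCode : Bool → Real → Real
largeCode true  X = opposite X
largeCode false X = X

computable-largeCode : TuringComputable (λ X → largeCode (typeBit X) (dropType X))
computable-largeCode = turingComputable (computable-≗
  (computable-if (computable-query computable-zero)
                 (pointwise (computable-opposite computable-dropType))
                 (pointwise computable-dropType))
  (λ X xs → if-largeCode (X 0) (dropType X) (lookup xs (# 0))))
  where
  computable-dropType : TuringComputable dropType
  computable-dropType = turingComputable (computable-query (computable-suc var₀))
  if-largeCode : ∀ b W n → (if b then bit (opposite W n) else bit (W n)) ≡ bit (largeCode b W n)
  if-largeCode true  W n = refl
  if-largeCode false W n = refl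

SCAC-type≤SCAC-large : SCAC-type ≤W SCAC-large
SCAC-type≤SCAC-large = ≤W-byInstances (λ X → largeCode (typeBit X) (dropType X)) computable-largeCode
  largeCode-instance largeCode-solution
  where
  largeCode-instance : ∀ X → Inst SCAC-type X → Inst SCAC-large (largeCode (typeBit X) (dropType X))
  largeCode-instance X (isP , inf , _ , small , large) with typeBit X
  ... | true  = let open Opposite (dropType X) in isPoset-op isP , infinite-op inf , stableSmall-op (small refl)
  ... | false = isP , inf , large refl
  largeCode-solution : ∀ X Ŷ → Inst SCAC-type X →
                       Sol SCAC-large (largeCode (typeBit X) (dropType X)) Ŷ → Sol SCAC-type X Ŷ
  largeCode-solution X Ŷ _ sol with typeBit X
  ... | true  = Opposite.solution-unop (dropType X) Ŷ sol
  ... | false = sol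

-- Restricting a poset to an ω-ordered one

∧≡true⇒ : ∀ {a b} → (a ∧ b) ≡ true → a ≡ true × b ≡ true
∧≡true⇒ {true} {true} _ = refl , refl

∧≡true⇐ : ∀ {a b} → a ≡ true → b ≡ true → (a ∧ b) ≡ true
∧≡true⇐ refl refl = refl

does≡true⇒ : ∀ {A : Set} (a? : Dec A) → does a? ≡ true → A
does≡true⇒ (yes a) _ = a

ωRestrict : Real → Real
ωRestrict X n = if isEven n then X n else X n ∧ does (unpair₁ (half n) ≤? unpair₂ (half n))

ωRestrict-double : ∀ X x → ωRestrict X (double x) ≡ X (double x)
ωRestrict-double X x rewrite isEven-double x = refl

ωRestrict-order : ∀ X x y →
                  ωRestrict X (suc (double (pair x y))) ≡ (X (suc (double (pair x y))) ∧ does (x ≤? y))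
ωRestrict-order X x y rewrite isEven-suc-double (pair x y) | half-suc-double (pair x y)
                           | unpair₁-pair x y | unpair₂-pair x y = refl

computable-ωRestrict : TuringComputable ωRestrict
computable-ωRestrict = turingComputable (computable-≗
  (computable-if (computable-isEven var₀) (computable-query var₀)
    (computable-∧ (computable-query var₀)
                  (computable-≤? (computable-unpair₁ (computable-half var₀))
                                 (computable-unpair₂ (computable-half var₀)))))
  (λ X xs → sym (if-float bit (isEven (lookup xs (# 0))))))

module ωRestriction (X : Real) where
  private
    P  = poset X
    Pω = poset (ωRestrict X)

  dom-ω : ∀ x → Dom P x → Dom Pω x
  dom-ω x = trans (ωRestrict-double X x)

  dom-unω : ∀ x → Dom Pω x → Dom P x
  dom-unω x = trans (sym (ωRestrict-double X x))

  ≤-unω : ∀ x y → _≤P_ Pω x y → _≤P_ P x y × x ≤ y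
  ≤-unω x y (dx , dy , x≤y) =
    let (x≤ₚy , x≤?y) = ∧≡true⇒ (trans (sym (ωRestrict-order X x y)) x≤y)
    in (dom-unω x dx , dom-unω y dy , x≤ₚy) , does≡true⇒ (x ≤? y) x≤?y

  ≤-ω : ∀ x y → _≤P_ P x y → x ≤ y → _≤P_ Pω x y
  ≤-ω x y (dx , dy , x≤ₚy) x≤y =
    dom-ω x dx , dom-ω y dy , trans (ωRestrict-order X x y) (∧≡true⇐ x≤ₚy (dec-true (x ≤? y) x≤y))

  comparable-unω : ∀ x y → Comparable Pω x y → Comparable P x y
  comparable-unω x y (inj₁ x≤y) = inj₁ (proj₁ (≤-unω x y x≤y))
  comparable-unω x y (inj₂ y≤x) = inj₂ (proj₁ (≤-unω y x y≤x))

  isPoset-ω : IsPoset P → IsPoset Pω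
  isPoset-ω (refl′ , antisym , trans′) =
    (λ x dx → ≤-ω x x (refl′ x (dom-unω x dx)) ≤-refl) ,
    (λ x y x≤y y≤x → antisym x y (proj₁ (≤-unω x y x≤y)) (proj₁ (≤-unω y x y≤x))) ,
    (λ x y z x≤y y≤z →
       let (x≤ₚy , x≤y′) = ≤-unω x y x≤y ; (y≤ₚz , y≤z′) = ≤-unω y z y≤z
       in ≤-ω x z (trans′ x y z x≤ₚy y≤ₚz) (≤-trans x≤y′ y≤z′))

  infinite-ω : Infinite P → Infinite Pω
  infinite-ω inf n = let (m , n≤m , dm) = inf n in m , n≤m , dom-ω m dm

  ωOrdered-ω : ωOrdered Pω
  ωOrdered-ω x y x≤y = proj₂ (≤-unω x y x≤y)

  stableSmall-ω : StableSmall P → StableSmall Pω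
  stableSmall-ω stable x dx with stable x (dom-unω x dx)
  ... | inj₁ (b , small) = inj₁ (b ⊔ x , λ y dy b⊔x≤y →
          ≤-ω x y (small y (dom-unω y dy) (≤-trans (m≤m⊔n b x) b⊔x≤y)) (≤-trans (m≤n⊔m b x) b⊔x≤y))
  ... | inj₂ (b , isol) = inj₂ (b , λ y dy b≤y c → isol y (dom-unω y dy) b≤y (comparable-unω x y c))

-- Extracting a solution

allBelow : (ℕ → Bool) → ℕ → Bool
allBelow p zero    = true
allBelow p (suc k) = allBelow p k ∧ p k

allBelow-true : ∀ p k → allBelow p k ≡ true → ∀ m → m < k → p m ≡ true
allBelow-true p (suc k) all m m<1+k with ∧≡true⇒ {allBelow p k} all | m≤n⇒m<n∨m≡n (≤-pred m<1+k)
... | all-k , _  | inj₁ m<k  = allBelow-true p k all-k m m<k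
... | _     , pk | inj₂ refl = pk

allBelow-false : ∀ p k → allBelow p k ≡ false → Σ ℕ λ m → m < k × p m ≡ false
allBelow-false p (suc k) none with allBelow p k in all-k | p k in pk
... | false | _     = let (m , m<k , pm) = allBelow-false p k all-k in m , m≤n⇒m≤1+n m<k , pm
... | true  | false = k , ≤-refl , pk

allBelow-cong : ∀ {p q} → (∀ m → p m ≡ q m) → ∀ k → allBelow p k ≡ allBelow q k
allBelow-cong p≗q zero    = refl
allBelow-cong p≗q (suc k) = cong₂ _∧_ (allBelow-cong p≗q k) (p≗q k)

computable-allBelow : ∀ {n} {p : Real → ℕ → ℕ → Bool} {f g : OracleFn n} →
                      Computableᵇ {2} (λ X xs → p X (lookup xs (# 0)) (lookup xs (# 1))) →
                      Computable f → Computable g →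
                      Computableᵇ (λ X xs → allBelow (p X (f X xs)) (g X xs))
computable-allBelow {p = p} cp cf cg = compose₂ bounded cg cf
  where
  bounded : Computableᵇ (λ X xs → allBelow (p X (lookup xs (# 1))) (lookup xs (# 0)))
  bounded = primRec computable-true
    (computable-∧ (computable-not (computable-≟0 var₁))
                  (compose₂ cp (computable-var (# 2)) var₀))
    _
    (λ { _ (_ ∷ []) → refl })
    (λ { X k (n ∷ []) → cong (λ b → bit (b ∧ p X n k))
                             (sym (trans (cong not (does-bit≟0 (allBelow (p X n) k))) (not-involutive _))) })

DominatedIn : Real → Real → ℕ → Set
DominatedIn X Y n = Σ ℕ λ m → m < n × m ∈ˢ Y × suc (double (pair n m)) ∈ˢ X

undominatedPart : Real → Real → Real
undominatedPart X Y n = Y n ∧ allBelow (λ m → not (Y m ∧ X (suc (double (pair n m))))) n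

undominatedPart-⊆ : ∀ X Y n → n ∈ˢ undominatedPart X Y → n ∈ˢ Y × ¬ DominatedIn X Y n
undominatedPart-⊆ X Y n n∈M with ∧≡true⇒ {Y n} n∈M
... | n∈Y , undominated = n∈Y , λ (m , m<n , m∈Y , n≤m) →
  case (allBelow-true _ n undominated m m<n) m∈Y n≤m
  where
  case : ∀ {a b} → not (a ∧ b) ≡ true → a ≡ true → b ≡ true → ⊥
  case () refl refl

undominatedPart-⊇ : ∀ X Y n → n ∈ˢ Y → n ∈ˢ undominatedPart X Y ⊎ DominatedIn X Y n
undominatedPart-⊇ X Y n n∈Y with allBelow (λ m → not (Y m ∧ X (suc (double (pair n m))))) n in all-n
... | true  = inj₁ (∧≡true⇐ n∈Y refl)
... | false = let (m , m<n , dominates) = allBelow-false _ n all-n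
                  (m∈Y , n≤m) = ∧≡true⇒ (trans (sym (not-involutive _)) (cong not dominates))
              in inj₂ (m , m<n , m∈Y , n≤m)

undominatedPartᴶ : Real → Real
undominatedPartᴶ W n =
  W (suc (double n)) ∧ allBelow (λ m → not (W (suc (double m)) ∧ W (double (suc (double (pair n m)))))) n

undominatedPartᴶ-⊕ : ∀ X Y n → undominatedPartᴶ (X ⊕ Y) n ≡ undominatedPart X Y n
undominatedPartᴶ-⊕ X Y n = cong₂ _∧_ (⊕-suc-double X Y n) (allBelow-cong
  (λ m → cong₂ (λ a b → not (a ∧ b)) (⊕-suc-double X Y m) (⊕-double X Y (suc (double (pair n m))))) n)

computable-undominatedPartᴶ : TuringComputable undominatedPartᴶ
computable-undominatedPartᴶ = turingComputable (computable-∧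
  (computable-query (computable-suc (computable-double var₀)))
  (computable-allBelow {p = λ W n m → not (W (suc (double m)) ∧ W (double (suc (double (pair n m)))))}
    (computable-not (computable-∧ (computable-query (computable-suc (computable-double var₁)))
                                   (computable-query (computable-double (computable-suc (computable-double
                                     (computable-pair var₀ var₁)))))))
    var₀ var₀))

isolationThreshold : ∀ (P : CPoset) (Y : Real) → (∀ a → a ∈ˢ Y → Isolated P a) → ∀ a →
                     Σ ℕ λ b → a ∈ˢ Y → ∀ y → Dom P y → b ≤ y → ¬ Comparable P a y
isolationThreshold P Y isolated a with Y a in a∈Y
... | true  = let (b , isol) = isolated a a∈Y in b , λ _ → isol
... | false = 0 , λ ()

isolationBound : ∀ (P : CPoset) (Y : Real) → (∀ a → a ∈ˢ Y → Isolated P a) → ∀ N →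
                 Σ ℕ λ B → ∀ a → a < N → a ∈ˢ Y → ∀ y → Dom P y → B ≤ y → ¬ Comparable P a y
isolationBound P Y isolated zero = 0 , λ _ ()
isolationBound P Y isolated (suc N)
  with isolationBound P Y isolated N | isolationThreshold P Y isolated N
... | B , belowN | b , isolatedN = B ⊔ b , bound
  where
  bound : ∀ a → a < suc N → a ∈ˢ Y → ∀ y → Dom P y → B ⊔ b ≤ y → ¬ Comparable P a y
  bound a a<1+N a∈Y y dy B⊔b≤y with m≤n⇒m<n∨m≡n (≤-pred a<1+N)
  ... | inj₁ a<N  = belowN a a<N a∈Y y dy (≤-trans (m≤m⊔n B b) B⊔b≤y)
  ... | inj₂ refl = isolatedN a∈Y y dy (≤-trans (m≤n⊔m B b) B⊔b≤y)

module ωSolution (X : Real) (isP : IsPoset (poset X)) (stable : StableSmall (poset X))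
                 (Y : Real) (Y-infinite : InfiniteSubset (poset (ωRestrict X)) Y) where
  open ωRestriction X
  private
    P  = poset X
    Pω = poset (ωRestrict X)
    M  = undominatedPart X Y

  domY : ∀ y → y ∈ˢ Y → Dom P y
  domY y y∈Y = dom-unω y (proj₁ Y-infinite y y∈Y)

  M⊆Y : ∀ n → n ∈ˢ M → n ∈ˢ Y
  M⊆Y n n∈M = proj₁ (undominatedPart-⊆ X Y n n∈M)

  M⊆P : ∀ n → n ∈ˢ M → Dom P n
  M⊆P n n∈M = domY n (M⊆Y n n∈M)

  ≤-ofBit : ∀ {x y} → x ∈ˢ Y → y ∈ˢ Y → suc (double (pair x y)) ∈ˢ X → _≤P_ P x y
  ≤-ofBit {x} {y} x∈Y y∈Y x≤y = domY x x∈Y , domY y y∈Y , x≤y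

  chain-undominated : Chain Pω Y → ∀ n → n ∈ˢ Y → ¬ DominatedIn X Y n
  chain-undominated chain n n∈Y (m , m<n , m∈Y , n≤m) with chain n m n∈Y m∈Y
  ... | inj₁ n≤ωm = <⇒≱ m<n (proj₂ (≤-unω n m n≤ωm))
  ... | inj₂ m≤ωn = <⇒≢ m<n (proj₁ (proj₂ isP) m n (proj₁ (≤-unω m n m≤ωn)) (≤-ofBit n∈Y m∈Y n≤m))

  chain-solution : Chain Pω Y → ChainOrAntichain P M
  chain-solution chain =
    (M⊆P , λ N → let (m , N≤m , m∈Y) = proj₂ Y-infinite N in m , N≤m , Y⊆M m m∈Y) ,
    inj₁ (λ x y x∈M y∈M → comparable-unω x y (chain x y (M⊆Y x x∈M) (M⊆Y y y∈M)))
    where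
    Y⊆M : ∀ n → n ∈ˢ Y → n ∈ˢ M
    Y⊆M n n∈Y with undominatedPart-⊇ X Y n n∈Y
    ... | inj₁ n∈M       = n∈M
    ... | inj₂ dominated = ⊥-elim (chain-undominated chain n n∈Y dominated)

  antichain-incomparable : Antichain Pω Y → ∀ a b → a < b → a ∈ˢ M → b ∈ˢ M → ¬ Comparable P a b
  antichain-incomparable antichain a b a<b a∈M b∈M (inj₁ a≤b) =
    antichain a b (M⊆Y a a∈M) (M⊆Y b b∈M) (<⇒≢ a<b) (inj₁ (≤-ω a b a≤b (<⇒≤ a<b)))
  antichain-incomparable antichain a b a<b a∈M b∈M (inj₂ (_ , _ , b≤a)) =
    proj₂ (undominatedPart-⊆ X Y b b∈M) (a , a<b , M⊆Y a a∈M , b≤a)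

  undominated-antichain : Antichain Pω Y → Antichain P M
  undominated-antichain antichain x y x∈M y∈M x≢y c with <-cmp x y
  ... | tri< x<y _ _ = antichain-incomparable antichain x y x<y x∈M y∈M c
  ... | tri≈ _ x≡y _ = x≢y x≡y
  ... | tri> _ _ y<x = antichain-incomparable antichain y x y<x y∈M x∈M (swap c)

  antichain-isolated : Antichain Pω Y → ∀ a → a ∈ˢ Y → Isolated P a
  antichain-isolated antichain a a∈Y with stable a (domY a a∈Y)
  ... | inj₂ isol        = isol
  ... | inj₁ (b , small) =
    let (m , b⊔1+a≤m , m∈Y) = proj₂ Y-infinite (b ⊔ suc a)
        a<m = ≤-trans (m≤n⊔m b (suc a)) b⊔1+a≤m
        a≤m = small m (domY m m∈Y) (≤-trans (m≤m⊔n b (suc a)) b⊔1+a≤m)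
    in ⊥-elim (antichain a m a∈Y m∈Y (<⇒≢ a<m) (inj₁ (≤-ω a m a≤m (<⇒≤ a<m))))

  -- Descend from z through earlier elements of Y above it; none of them is below N,
  -- since the elements of Y below N are incomparable with z.
  undominated-infinite : Antichain Pω Y → ∀ N → Σ ℕ λ k → N ≤ k × k ∈ˢ M
  undominated-infinite antichain N with isolationBound P Y (antichain-isolated antichain) N
  ... | B , belowN with proj₂ Y-infinite (N ⊔ B)
  ...   | z , N⊔B≤z , z∈Y =
    <-rec Descent descend z z∈Y (≤-trans (m≤m⊔n N B) N⊔B≤z) (proj₁ isP z (domY z z∈Y))
    where
    Descent : ℕ → Set
    Descent m = m ∈ˢ Y → N ≤ m → _≤P_ P z m → Σ ℕ λ k → N ≤ k × k ∈ˢ M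
    descend : ∀ m → (∀ {k} → k < m → Descent k) → Descent m
    descend m rec m∈Y N≤m z≤m with undominatedPart-⊇ X Y m m∈Y
    ... | inj₁ m∈M = m , N≤m , m∈M
    ... | inj₂ (k , k<m , k∈Y , m≤k) = rec k<m k∈Y N≤k z≤k
      where
      z≤k : _≤P_ P z k
      z≤k = proj₂ (proj₂ isP) z m k z≤m (≤-ofBit m∈Y k∈Y m≤k)
      N≤k : N ≤ k
      N≤k with k <? N
      ... | yes k<N = ⊥-elim (belowN k k<N k∈Y z (domY z z∈Y) (≤-trans (m≤n⊔m N B) N⊔B≤z) (inj₂ z≤k))
      ... | no  k≮N = ≮⇒≥ k≮N

  antichain-solution : Antichain Pω Y → ChainOrAntichain P M
  antichain-solution antichain = (M⊆P , undominated-infinite antichain) , inj₂ (undominated-antichain antichain)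

solution-unω : ∀ X → IsPoset (poset X) → StableSmall (poset X) → ∀ Y →
               ChainOrAntichain (poset (ωRestrict X)) Y → ChainOrAntichain (poset X) (undominatedPart X Y)
solution-unω X isP stable Y (Y-infinite , inj₁ chain) =
  ωSolution.chain-solution X isP stable Y Y-infinite chain
solution-unω X isP stable Y (Y-infinite , inj₂ antichain) =
  ωSolution.antichain-solution X isP stable Y Y-infinite antichain

SCAC-small≤ω-SCAC : SCAC-small ≤W ω-SCAC
SCAC-small≤ω-SCAC = ≤W-intro ωRestrict undominatedPart (functional computable-undominatedPartᴶ) computable-ωRestrict
  (λ X Y → ≣-cong (functional-≣ computable-undominatedPartᴶ (X ⊕ Y)) (undominatedPartᴶ-⊕ X Y))
  (λ X (isP , inf , stable) → let open ωRestriction X in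
     isPoset-ω isP , infinite-ω inf , ωOrdered-ω , inj₁ (stableSmall-ω stable))
  (λ X Ŷ (isP , _ , stable) → solution-unω X isP stable Ŷ)

corollary3 : (ω-SCAC ≡W SCAC-small) × (SCAC-small ≡W SCAC-large) × (SCAC-large ≡W SCAC-type)
corollary3 = (ω-SCAC≤SCAC-small , SCAC-small≤ω-SCAC) ,
             (SCAC-small≤SCAC-large , SCAC-large≤SCAC-small) ,
             (SCAC-large≤SCAC-type , SCAC-type≤SCAC-large)
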